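{- Let $S_1,\ldots,S_\ell$ be finite sets (the sets of a lazy partition heap) with $|S_j|\ge 1$ for all $1\le j\le \ell$, and let $n=|S_1|+\cdots+|S_\ell|$. For $1\le j\le \ell$ let $s_j=|S_1|+\cdots+|S_{j-1}|$ (so $s_1=0$). Suppose that the concatenation rule (C) applies to no pair of adjacent sets, i.e. $|S_j|+|S_{j+1}|\ge s_j$ for every $1\le j<\ell$. Then $\ell\le 2\lg n+1$.
   Context: $\lg$ denotes the binary logarithm. In a lazy partition heap the stored elements are partitioned into sets $S_1,\ldots,S_\ell$ such that all elements of $S_i$ are smaller than all elements of $S_j$ for $i<j$. The concatenation rule (C) says: if $|S_j|+|S_{j+1}|<s_j$, concatenate $S_j$ and $S_{j+1}$ into a single set. -}

module Defs where

open import Data.Nat using (ℕ; zero; suc; _+_)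
open import Data.Fin using (Fin; zero; suc)

-- Sizes of the sets S_1..S_ℓ given as a function c : Fin ℓ → ℕ (0-indexed).
-- prefix c j = c 0 + ... + c (j-1)  (sum of the first j sizes), for j ≤ ℓ.
prefix : ∀ {ℓ} → (Fin ℓ → ℕ) → ℕ → ℕ
prefix {zero}  c _       = 0
prefix {suc ℓ} c zero    = 0
prefix {suc ℓ} c (suc j) = c zero + prefix {ℓ} (λ i → c (suc i)) j

total : ∀ {ℓ} → (Fin ℓ → ℕ) → ℕ
total {ℓ} c = prefix c ℓ

-- Write P j = |S_1| + ... + |S_j|. Since P (j + 2) = P j + |S_{j+1}| + |S_{j+2}| ≥ 2 P j
-- by the hypothesis, the partial sums at least double every two steps; together with
-- P 1 ≥ 1 and P 2 ≥ 2 this gives 2 ^ j ≤ P (j + 1) ^ 2, and j = ℓ - 1 is the claim.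
module Submission where

open import Defs
open import Data.Nat using (ℕ; zero; suc; _+_; _*_; _^_; _≤_; _<_; z≤n; s≤s)
open import Data.Nat.Properties
open import Data.Fin using (Fin; toℕ; inject₁; fromℕ<)
open import Data.Fin.Properties using (toℕ-inject₁; toℕ-fromℕ<)
open import Function using (_∘_)
open import Relation.Binary.PropositionalEquality
open import Data.Nat.Solver using (module +-*-Solver)
open +-*-Solver using (solve; _:*_; _:^_; _:=_; con)

[2*m]^2≡4*m^2 : ∀ m → (2 * m) ^ 2 ≡ 4 * m ^ 2
[2*m]^2≡4*m^2 = solve 1 (λ m → (con 2 :* m) :^ 2 := con 4 :* (m :^ 2)) refl

2^j≤P[1+j]^2 : (k : ℕ) (P : ℕ → ℕ) →
  (∀ j → j ≤ suc k → j ≤ P j) →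
  (∀ i → i < k → 2 * P i ≤ P (2 + i)) →
  ∀ j → j ≤ k → 2 ^ j ≤ P (suc j) ^ 2
2^j≤P[1+j]^2 k P id≤P doubling zero _ = ^-monoˡ-≤ 2 (id≤P 1 (s≤s z≤n))
2^j≤P[1+j]^2 k P id≤P doubling (suc zero) 1≤k =
  ≤-trans (s≤s (s≤s z≤n)) (^-monoˡ-≤ 2 (id≤P 2 (s≤s 1≤k)))
2^j≤P[1+j]^2 k P id≤P doubling (suc (suc j)) 2+j≤k = begin
  2 ^ (2 + j)           ≡⟨ *-assoc 2 2 (2 ^ j) ⟨
  4 * 2 ^ j             ≤⟨ *-monoʳ-≤ 4 (2^j≤P[1+j]^2 k P id≤P doubling j (≤-trans (n≤1+n j) (<⇒≤ 2+j≤k))) ⟩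
  4 * P (suc j) ^ 2     ≡⟨ [2*m]^2≡4*m^2 (P (suc j)) ⟨
  (2 * P (suc j)) ^ 2   ≤⟨ ^-monoˡ-≤ 2 (doubling (suc j) 2+j≤k) ⟩
  P (3 + j) ^ 2         ∎
  where open ≤-Reasoning

prefix-zero : ∀ {ℓ} (c : Fin ℓ → ℕ) → prefix c 0 ≡ 0
prefix-zero {zero}  c = refl
prefix-zero {suc ℓ} c = refl

prefix-suc : ∀ {ℓ} (c : Fin ℓ → ℕ) (i : Fin ℓ) → prefix c (suc (toℕ i)) ≡ prefix c (toℕ i) + c i
prefix-suc {suc ℓ} c Fin.zero = begin
  c Fin.zero + prefix {ℓ} (c ∘ Fin.suc) 0 ≡⟨ cong (c Fin.zero +_) (prefix-zero (c ∘ Fin.suc)) ⟩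
  c Fin.zero + 0                          ≡⟨ +-comm (c Fin.zero) 0 ⟩
  c Fin.zero                              ∎
  where open ≡-Reasoning
prefix-suc {suc ℓ} c (Fin.suc i) = begin
  c Fin.zero + prefix (c ∘ Fin.suc) (suc (toℕ i))   ≡⟨ cong (c Fin.zero +_) (prefix-suc (c ∘ Fin.suc) i) ⟩
  c Fin.zero + (prefix (c ∘ Fin.suc) (toℕ i) + c (Fin.suc i)) ≡⟨ +-assoc (c Fin.zero) _ _ ⟨
  c Fin.zero + prefix (c ∘ Fin.suc) (toℕ i) + c (Fin.suc i)   ∎
  where open ≡-Reasoning

index≤prefix : ∀ {ℓ} (c : Fin ℓ → ℕ) → (∀ i → 1 ≤ c i) → ∀ j → j ≤ ℓ → j ≤ prefix c j
index≤prefix {zero}  c pos zero    _           = z≤n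
index≤prefix {suc ℓ} c pos zero    _           = z≤n
index≤prefix {suc ℓ} c pos (suc j) (s≤s j≤ℓ) =
  +-mono-≤ (pos Fin.zero) (index≤prefix (c ∘ Fin.suc) (pos ∘ Fin.suc) j j≤ℓ)

prefix-doubling : ∀ {k} (c : Fin (suc k) → ℕ) →
  (∀ (i : Fin k) → prefix c (toℕ i) ≤ c (inject₁ i) + c (Fin.suc i)) →
  ∀ (i : Fin k) → 2 * prefix c (toℕ i) ≤ prefix c (2 + toℕ i)
prefix-doubling c no-concat i = begin
  2 * p                                    ≡⟨ cong (p +_) (+-identityʳ p) ⟩
  p + p                                    ≤⟨ +-monoʳ-≤ p (no-concat i) ⟩
  p + (c (inject₁ i) + c (Fin.suc i))      ≡⟨ +-assoc p _ _ ⟨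
  p + c (inject₁ i) + c (Fin.suc i)        ≡⟨ cong (_+ c (Fin.suc i)) prefix-suc-inject₁ ⟨
  prefix c (suc (toℕ i)) + c (Fin.suc i)   ≡⟨ prefix-suc c (Fin.suc i) ⟨
  prefix c (2 + toℕ i)                     ∎
  where
  open ≤-Reasoning
  p : ℕ
  p = prefix c (toℕ i)
  prefix-suc-inject₁ : prefix c (suc (toℕ i)) ≡ p + c (inject₁ i)
  prefix-suc-inject₁ rewrite sym (toℕ-inject₁ i) = prefix-suc c (inject₁ i)

lemma1 : (k : ℕ) (c : Fin (suc k) → ℕ) →
    (∀ i → 1 ≤ c i) →
    (∀ (i : Fin k) → prefix c (toℕ i) ≤ c (inject₁ i) + c (Fin.suc i)) →
    2 ^ k ≤ total c ^ 2
lemma1 k c pos no-concat =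
  2^j≤P[1+j]^2 k (prefix c) (index≤prefix c pos) doubling k ≤-refl
  where
  doubling : ∀ i → i < k → 2 * prefix c i ≤ prefix c (2 + i)
  doubling i i<k = subst (λ m → 2 * prefix c m ≤ prefix c (2 + m))
    (toℕ-fromℕ< i<k) (prefix-doubling c no-concat (fromℕ< i<k))
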